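{- Let $H$ be a hypergraph, $(Red,X,Blue)$ a partition of $V(H)$ such that no edge contains both a red and a blue vertex, and $F$ a reduced elimination forest of $H$. Let $U'\subseteq Red\cup Blue$ be a context factor of $F$ and let $P'$ be a colour interval of its spine. Then all vertices of $P'$ have the same foreign bag, i.e. $\mathrm{fbag}_F(u_1)=\mathrm{fbag}_F(u_2)$ for all $u_1,u_2\in V(P')$.
   Context: Hypergraph: finite vertex set, edges non-empty subsets; vertices adjacent if some edge contains both. Elimination forest $F$: rooted forest on $V(H)$ with vertices of a common edge in ancestor–descendant relation; $F_u$ = descendants of $u$; $\mathrm{bag}_F(u)$ = $u$ plus ancestors adjacent to $u$ or to a descendant of $u$. Reduced: each non-leaf $u$ adjacent to some vertex of $F_v$ for each child $v$. Context factor: $F_x\setminus B$, $B$ a non-empty union of $F_y$ over sibling strict descendants $y$ of $x$; spine: path from $x$ to the parent of the $y$'s. Colour interval: maximal subpath of the spine contained in $Red$ or in $Blue$. For $u\in Red$ let $Foreign(u)=Blue$, for $u\in Blue$ let $Foreign(u)=Red$; $\mathrm{fbag}_F(u)=\mathrm{bag}_F(u)\cap Foreign(u)$. -}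

module Defs where

open import Data.Nat using (ℕ)
open import Data.Fin using (Fin)
open import Data.Fin.Subset using (Subset; _∈_; Nonempty)
open import Data.Maybe using (Maybe; just)
open import Data.Product using (Σ; ∃; _×_)
open import Data.Sum using (_⊎_)
open import Data.List using (List)
open import Data.List.Relation.Unary.Any using (Any)
open import Data.List.Relation.Unary.All using (All)
open import Relation.Nullary using (¬_)
open import Relation.Binary.PropositionalEquality using (_≡_; _≢_)
open import Data.Empty using (⊥)
open import Data.Unit using (⊤)

record Hypergraph (n : ℕ) : Set where
  field
    m        : ℕ
    edge     : Fin m → Subset n
    nonempty : ∀ i → Nonempty (edge i)
open Hypergraph public

Adj : ∀ {n} → Hypergraph n → Fin n → Fin n → Set
Adj H u v = ∃ λ i → u ∈ edge H i × v ∈ edge H i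

data StrictAnc {n : ℕ} (par : Fin n → Maybe (Fin n)) : Fin n → Fin n → Set where
  here  : ∀ {a d} → par d ≡ just a → StrictAnc par a d
  there : ∀ {a w d} → par d ≡ just w → StrictAnc par a w → StrictAnc par a d

record Forest (n : ℕ) : Set where
  field
    parent  : Fin n → Maybe (Fin n)
    acyclic : ∀ u → ¬ StrictAnc parent u u
open Forest public

module _ {n : ℕ} (F : Forest n) where
  Anc< : Fin n → Fin n → Set
  Anc< = StrictAnc (parent F)

  -- d ∈ F_u  (descendants, including u itself)
  Desc : Fin n → Fin n → Set
  Desc u d = d ≡ u ⊎ Anc< u d

IsEliminationForest : ∀ {n} → Hypergraph n → Forest n → Set
IsEliminationForest {n} H F =
  ∀ (i : Fin (m H)) (u v : Fin n) → u ∈ edge H i → v ∈ edge H i →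
    Desc F u v ⊎ Desc F v u

bag : ∀ {n} → Hypergraph n → Forest n → Fin n → Fin n → Set
bag H F u w = w ≡ u ⊎ (Anc< F w u × ∃ λ d → Desc F u d × Adj H w d)

IsReduced : ∀ {n} → Hypergraph n → Forest n → Set
IsReduced H F = ∀ u v → parent F v ≡ just u → ∃ λ d → Desc F v d × Adj H u d

data Colour : Set where
  red x blue : Colour

NoRedBlueEdge : ∀ {n} → Hypergraph n → (Fin n → Colour) → Set
NoRedBlueEdge H col = ∀ i u v → u ∈ edge H i → v ∈ edge H i →
  col u ≡ red → col v ≢ blue

-- Foreign(u) as a predicate on colours (only used for u ∈ Red ∪ Blue)
Foreign : Colour → Colour → Set
Foreign red  c = c ≡ blue
Foreign blue c = c ≡ red
Foreign x    c = ⊥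

fbag : ∀ {n} → Hypergraph n → (Fin n → Colour) → Forest n → Fin n → Fin n → Set
fbag H col F u w = bag H F u w × Foreign (col u) (col w)

-- Context factor data: top vertex x₀, vertex p ∈ F_{x₀} (the common parent),
-- and a non-empty list Y of children of p (siblings, strict descendants of x₀).
record ContextFactor {n : ℕ} (F : Forest n) : Set where
  field
    top    : Fin n
    bot    : Fin n
    botIn  : Desc F top bot
    Y      : List (Fin n)
    Yne    : Any (λ _ → ⊤) Y
    Ychild : All (λ y → parent F y ≡ just bot) Y
open ContextFactor public

module _ {n : ℕ} (F : Forest n) (C : ContextFactor F) where
  InFactor : Fin n → Set
  InFactor w = Desc F (top C) w × All (λ y → ¬ Desc F y w) (Y C)

  OnSpine : Fin n → Set
  OnSpine v = Desc F (top C) v × Desc F v (bot C)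

  IsSubpath : Fin n → Fin n → Set
  IsSubpath a b = OnSpine a × OnSpine b × Desc F a b

  InSubpath : Fin n → Fin n → Fin n → Set
  InSubpath a b v = Desc F a v × Desc F v b

  Monochrome : (Fin n → Colour) → Colour → Fin n → Fin n → Set
  Monochrome col c a b = ∀ v → InSubpath a b v → col v ≡ c

  IsColourInterval : (Fin n → Colour) → Fin n → Fin n → Set
  IsColourInterval col a b = IsSubpath a b × ∃ λ c → (c ≡ red ⊎ c ≡ blue) ×
    Monochrome col c a b ×
    (∀ a' b' → IsSubpath a' b' → Desc F a' a → Desc F b b' →
       Monochrome col c a' b' → a' ≡ a × b' ≡ b)

-- Let u₁, u₂ lie on a red (say) subpath of the spine and let w ∈ fbag(u₁) be blue, i.e. a strict
-- ancestor of u₁ adjacent to some d ∈ F_{u₁}. If u₂ is above u₁, then w, not being red, lies above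
-- the whole subpath and is in bag(u₂) with the same d. If u₂ is below u₁, push the neighbour of w
-- down the spine one edge t → t′ at a time: it is not t itself (no red–blue edge), and it is not in
-- the subtree of a sibling c of t′, because that subtree avoids Y, so lies in the factor and avoids X,
-- and it is connected and joined to t by reducedness, hence entirely red. So w has a neighbour in F_{t′}.
module Submission where

open import Defs
open import Data.Nat using (ℕ)
open import Data.Fin using (Fin; _≟_)
open import Data.Fin.Induction using (spo-wellFounded)
open import Data.Product using (_×_; _,_; ∃)
open import Data.Sum using (_⊎_; inj₁; inj₂)
open import Data.Maybe using (just)
open import Data.Maybe.Properties using (just-injective)
open import Data.Empty using (⊥-elim)
open import Data.List.Relation.Unary.All as All using (All)
open import Relation.Nullary using (¬_; yes; no)
open import Relation.Binary.PropositionalEquality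
open import Induction.WellFounded using (Acc; acc; WellFounded)

module ForestProperties {n : ℕ} (F : Forest n) where

  parent-unique : ∀ {d a b} → parent F d ≡ just a → parent F d ≡ just b → a ≡ b
  parent-unique p q = just-injective (trans (sym p) q)

  parent⇒Desc : ∀ {c p} → parent F c ≡ just p → Desc F p c
  parent⇒Desc e = inj₂ (here e)

  Anc<-trans : ∀ {a w d} → Anc< F a w → Anc< F w d → Anc< F a d
  Anc<-trans p (here q)    = there q p
  Anc<-trans p (there q r) = there q (Anc<-trans p r)

  Anc<-Desc-trans : ∀ {a w d} → Anc< F a w → Desc F w d → Anc< F a d
  Anc<-Desc-trans p (inj₁ refl) = p
  Anc<-Desc-trans p (inj₂ q)    = Anc<-trans p q

  Desc-trans : ∀ {a w d} → Desc F a w → Desc F w d → Desc F a d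
  Desc-trans (inj₁ refl) q = q
  Desc-trans (inj₂ p)    q = inj₂ (Anc<-Desc-trans p q)

  Anc<-parent⇒Desc : ∀ {a d p} → Anc< F a d → parent F d ≡ just p → Desc F a p
  Anc<-parent⇒Desc (here q)    e = inj₁ (parent-unique e q)
  Anc<-parent⇒Desc (there q r) e = inj₂ (subst (Anc< F _) (parent-unique q e) r)

  Anc<⇒child : ∀ {v d} → Anc< F v d → ∃ λ c → parent F c ≡ just v × Desc F c d
  Anc<⇒child (here q) = _ , q , inj₁ refl
  Anc<⇒child (there q r) with Anc<⇒child r
  ... | c , pc , dc = c , pc , Desc-trans dc (parent⇒Desc q)

  Anc<-comparable : ∀ {a b v} → Anc< F a v → Anc< F b v → Desc F a b ⊎ Desc F b a
  Anc<-comparable (here q)    (here r)    = inj₁ (inj₁ (parent-unique r q))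
  Anc<-comparable (here q)    (there r s) = inj₂ (inj₂ (subst (Anc< F _) (parent-unique r q) s))
  Anc<-comparable (there q s) (here r)    = inj₁ (inj₂ (subst (Anc< F _) (parent-unique q r) s))
  Anc<-comparable (there q s) (there r t) = Anc<-comparable s (subst (Anc< F _) (parent-unique r q) t)

  Desc-comparable : ∀ {a b v} → Desc F a v → Desc F b v → Desc F a b ⊎ Desc F b a
  Desc-comparable (inj₁ refl) q           = inj₂ q
  Desc-comparable (inj₂ p)    (inj₁ refl) = inj₁ (inj₂ p)
  Desc-comparable (inj₂ p)    (inj₂ q)    = Anc<-comparable p q

  parent⇒¬Desc : ∀ {c t} → parent F c ≡ just t → ¬ Desc F c t
  parent⇒¬Desc {c}     pc (inj₁ refl) = acyclic F c (here pc)
  parent⇒¬Desc {c} {t} pc (inj₂ c<t)  = acyclic F t (Anc<-trans (here pc) c<t)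

  siblings-disjoint : ∀ {c c′ t f} → parent F c ≡ just t → parent F c′ ≡ just t → c ≢ c′ →
                      Desc F c f → ¬ Desc F c′ f
  siblings-disjoint pc pc′ c≢c′ dcf dc′f with Desc-comparable dcf dc′f
  ... | inj₁ (inj₁ c′≡c) = c≢c′ (sym c′≡c)
  ... | inj₁ (inj₂ c<c′) = parent⇒¬Desc pc (Anc<-parent⇒Desc c<c′ pc′)
  ... | inj₂ (inj₁ c≡c′) = c≢c′ c≡c′
  ... | inj₂ (inj₂ c′<c) = parent⇒¬Desc pc′ (Anc<-parent⇒Desc c′<c pc)

  _⊏_ : Fin n → Fin n → Set
  c ⊏ v = Anc< F v c

  ⊏-wellFounded : WellFounded _⊏_
  ⊏-wellFounded = spo-wellFounded record
    { isEquivalence = isEquivalence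
    ; irrefl        = λ { {v} refl v<v → acyclic F v v<v }
    ; trans         = λ c⊏v v⊏u → Anc<-trans v⊏u c⊏v
    ; <-resp-≈      = (λ { refl p → p }) , (λ { refl p → p })
    }

open ForestProperties

Foreign-irrefl : ∀ {k} → ¬ Foreign k k
Foreign-irrefl {red}  ()
Foreign-irrefl {blue} ()
Foreign-irrefl {x}    ()

Foreign⇒≢x : ∀ {k l} → Foreign k l → k ≢ x
Foreign⇒≢x {red}  _ ()
Foreign⇒≢x {blue} _ ()
Foreign⇒≢x {x}    ()

Foreign-respˡ : ∀ {k l m} → k ≡ l → Foreign k m → Foreign l m
Foreign-respˡ refl f = f

module Colouring {n : ℕ} (H : Hypergraph n) (col : Fin n → Colour) (noRedBlue : NoRedBlueEdge H col) where

  Adj⇒sameColour : ∀ {u v} → Adj H u v → col u ≢ x → col v ≢ x → col u ≡ col v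
  Adj⇒sameColour {u} {v} (i , u∈i , v∈i) u≢x v≢x with col u in cu | col v in cv
  ... | red  | red  = refl
  ... | blue | blue = refl
  ... | red  | blue = ⊥-elim (noRedBlue i u v u∈i v∈i cu cv)
  ... | blue | red  = ⊥-elim (noRedBlue i v u v∈i u∈i cv cu)
  ... | x    | _    = ⊥-elim (u≢x refl)
  ... | _    | x    = ⊥-elim (v≢x refl)

  Foreign⇒¬Adj : ∀ {v w} → Foreign (col v) (col w) → ¬ Adj H w v
  Foreign⇒¬Adj {v} {w} fw (i , w∈i , v∈i) with col v in cv
  ... | red  = noRedBlue i v w v∈i w∈i cv fw
  ... | blue = noRedBlue i w v w∈i v∈i fw cv
  ... | x    = fw

  module Reduced (F : Forest n) (reduced : IsReduced H F) where

    XFree : Fin n → Set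
    XFree v = ∀ f → Desc F v f → col f ≢ x

    -- A reduced subtree is connected, and an edge between vertices outside X is monochromatic.
    XFree-monochromatic : ∀ {v} → Acc (_⊏_ F) v → XFree v → ∀ {f} → Desc F v f → col f ≡ col v
    XFree-child-colour : ∀ {c t} → Acc (_⊏_ F) c → parent F c ≡ just t → col t ≢ x → XFree c →
                         ∀ {f} → Desc F c f → col f ≡ col t

    XFree-monochromatic _         _     (inj₁ refl) = refl
    XFree-monochromatic {v} (acc rec) vFree (inj₂ v<f) with Anc<⇒child F v<f
    ... | c , pc , dcf = XFree-child-colour (rec (here pc)) pc (vFree v (inj₁ refl))
                           (λ f dcf → vFree f (Desc-trans F (parent⇒Desc F pc) dcf)) dcf

    XFree-child-colour {c} {t} accC pc t≢x cFree {f} dcf with reduced t c pc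
    ... | g , dcg , tAdjg = begin
      col f ≡⟨ monoC dcf ⟩
      col c ≡⟨ monoC dcg ⟨
      col g ≡⟨ Adj⇒sameColour tAdjg t≢x (cFree g dcg) ⟨
      col t ∎
      where
      open ≡-Reasoning
      monoC : ∀ {f} → Desc F c f → col f ≡ col c
      monoC = XFree-monochromatic accC cFree

    module InContextFactor (C : ContextFactor F)
                           (factorAvoidsX : ∀ w → InFactor F C w → col w ≢ x) where

      InFactor-offSpine : ∀ {t′ f} → Desc F (top C) f → Desc F t′ (bot C) → ¬ Desc F t′ f →
                          InFactor F C f
      InFactor-offSpine dtf dt′b ¬dt′f = dtf , All.map ¬dyf (Ychild C)
        where
        ¬dyf : ∀ {y} → parent F y ≡ just (bot C) → ¬ Desc F y _
        ¬dyf py dyf = ¬dt′f (Desc-trans F (Desc-trans F dt′b (parent⇒Desc F py)) dyf)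

      foreignNeighbour-stepDown : ∀ {t t′ w e} → parent F t′ ≡ just t →
                                  Desc F (top C) t → Desc F t′ (bot C) → Foreign (col t) (col w) →
                                  Desc F t e → Adj H w e →
                                  ∃ λ e′ → Desc F t′ e′ × Adj H w e′
      foreignNeighbour-stepDown _ _ _ fw (inj₁ refl) wAdje = ⊥-elim (Foreign⇒¬Adj fw wAdje)
      foreignNeighbour-stepDown {t} {t′} {e = e} pt′ dtopt dt′b fw (inj₂ t<e) wAdje
        with Anc<⇒child F t<e
      ... | c , pc , dce with c ≟ t′
      ...   | yes refl = e , dce , wAdje
      ...   | no c≢t′  = ⊥-elim (Foreign⇒¬Adj (Foreign-respˡ (sym colourₑ≡colourₜ) fw) wAdje)
        where
        cFree : XFree c
        cFree f dcf = factorAvoidsX f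
          (InFactor-offSpine (Desc-trans F dtopt (Desc-trans F (parent⇒Desc F pc) dcf)) dt′b
                             (siblings-disjoint F pc pt′ c≢t′ dcf))
        colourₑ≡colourₜ : col e ≡ col t
        colourₑ≡colourₜ = XFree-child-colour (⊏-wellFounded F c) pc (Foreign⇒≢x fw) cFree dce

      Monochrome-restrict : ∀ {c a b a′ b′} → Desc F a a′ → Desc F b′ b →
                            Monochrome F C col c a b → Monochrome F C col c a′ b′
      Monochrome-restrict daa′ db′b mono v (da′v , dvb′) =
        mono v (Desc-trans F daa′ da′v , Desc-trans F dvb′ db′b)

      foreignNeighbour-moveDown : ∀ {c u v w d} → Desc F (top C) u → Desc F v (bot C) →
                                  Anc< F u v → Monochrome F C col c u v → Foreign c (col w) →
                                  Desc F u d → Adj H w d → ∃ λ e → Desc F v e × Adj H w e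
      foreignNeighbour-moveDown {u = u} dtopu dvb (here pv) mono fw dud wAdjd =
        foreignNeighbour-stepDown pv dtopu dvb
          (Foreign-respˡ (sym (mono u (inj₁ refl , parent⇒Desc F pv))) fw) dud wAdjd
      foreignNeighbour-moveDown dtopu dvb (there {w = p} pv u<p) mono fw dud wAdjd
        with foreignNeighbour-moveDown dtopu (Desc-trans F (parent⇒Desc F pv) dvb) u<p
               (Monochrome-restrict (inj₁ refl) (parent⇒Desc F pv) mono) fw dud wAdjd
      ... | e , dpe , wAdje =
        foreignNeighbour-stepDown pv (Desc-trans F dtopu (inj₂ u<p)) dvb
          (Foreign-respˡ (sym (mono p (inj₂ u<p , parent⇒Desc F pv))) fw) dpe wAdje

      Foreign⇒∉Subpath : ∀ {c a b w} → Monochrome F C col c a b → Foreign c (col w) →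
                         ¬ InSubpath F C a b w
      Foreign⇒∉Subpath mono fw sw = Foreign-irrefl (Foreign-respˡ (sym (mono _ sw)) fw)

      bag-transfer : ∀ {c a b u₁ u₂ w} → IsSubpath F C a b → Monochrome F C col c a b →
                     Foreign c (col w) → InSubpath F C a b u₁ → InSubpath F C a b u₂ →
                     bag H F u₁ w → bag H F u₂ w
      bag-transfer _ mono fw s₁ _ (inj₁ refl) = ⊥-elim (Foreign⇒∉Subpath mono fw s₁)
      bag-transfer ((dtopa , _) , (_ , dbbot) , _) mono fw (dau₁ , du₁b) (dau₂ , du₂b)
                   (inj₂ (w<u₁ , d , du₁d , wAdjd)) with Desc-comparable F du₁b du₂b
      ... | inj₁ (inj₁ refl)  = inj₂ (w<u₁ , d , du₁d , wAdjd)
      ... | inj₁ (inj₂ u₁<u₂) = inj₂ (Anc<-trans F w<u₁ u₁<u₂ ,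
              foreignNeighbour-moveDown (Desc-trans F dtopa dau₁) (Desc-trans F du₂b dbbot) u₁<u₂
                (Monochrome-restrict dau₁ du₂b mono) fw du₁d wAdjd)
      ... | inj₂ du₂u₁ with Desc-comparable F (inj₂ w<u₁) du₂u₁
      ...   | inj₁ (inj₂ w<u₂) = inj₂ (w<u₂ , d , Desc-trans F du₂u₁ du₁d , wAdjd)
      ...   | inj₁ (inj₁ refl) = ⊥-elim (Foreign⇒∉Subpath mono fw (dau₂ , du₂b))
      ...   | inj₂ du₂w        =
        ⊥-elim (Foreign⇒∉Subpath mono fw (Desc-trans F dau₂ du₂w , Desc-trans F (inj₂ w<u₁) du₁b))

      fbag-transfer : ∀ {c a b u₁ u₂ w} → IsSubpath F C a b → Monochrome F C col c a b →
                      InSubpath F C a b u₁ → InSubpath F C a b u₂ →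
                      fbag H col F u₁ w → fbag H col F u₂ w
      fbag-transfer {u₁ = u₁} {u₂} sub mono s₁ s₂ (bag₁ , fw₁) =
        bag-transfer sub mono (Foreign-respˡ (mono u₁ s₁) fw₁) s₁ s₂ bag₁ ,
        Foreign-respˡ (trans (mono u₁ s₁) (sym (mono u₂ s₂))) fw₁

lemma38 : ∀ {n : ℕ} (H : Hypergraph n) (col : Fin n → Colour) →
    NoRedBlueEdge H col →
    (F : Forest n) → IsEliminationForest H F → IsReduced H F →
    (C : ContextFactor F) →
    (∀ w → InFactor F C w → col w ≢ x) →
    (a b : Fin n) → IsColourInterval F C col a b →
    ∀ u₁ u₂ → InSubpath F C a b u₁ → InSubpath F C a b u₂ →
    ∀ w → (fbag H col F u₁ w → fbag H col F u₂ w) × (fbag H col F u₂ w → fbag H col F u₁ w)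
lemma38 H col noRedBlue F _ reduced C factorAvoidsX a b (sub , _ , _ , mono , _) u₁ u₂ s₁ s₂ w =
  fbag-transfer sub mono s₁ s₂ , fbag-transfer sub mono s₂ s₁
  where open Colouring.Reduced.InContextFactor H col noRedBlue F reduced C factorAvoidsX
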